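{- Let $1\le j\le m-1$, $m\le n$ and $\ell\ge m$. Then $$E_m[\tau_j\mid \mathcal X_m^{(\ell)}]=\left\{{\ell-1\atop m-1}\right\}^{ -1}\sum_{k=1}^{\ell-m}j^k\left\{{\ell-k-1\atop m-1}\right\}.$$
   Context: Let $\mathbf X=\{X_1,\dots,X_n\}$ with uniform probability. For $1\le m\le n$, $\mathcal X_m$ is the set of finite sequences $\chi=(\chi_1,\dots,\chi_\ell)$ in $\mathbf X$ with $\{\chi_1,\dots,\chi_\ell\}$ of cardinality exactly $m$ and $\chi_\ell\ne\chi_j$ for $j<\ell$, with length $\ell=\ell(\chi)$ and probability $\mu(\chi)=n^{ -\ell(\chi)}$; $\mathcal X_m^{(\ell)}$ is the set of those of length $\ell$, and $E_m[\,\cdot\mid\mathcal X_m^{(\ell)}]$ is the conditional expectation given $\chi\in\mathcal X_m^{(\ell)}$ (i.e. the uniform average over $\mathcal X_m^{(\ell)}$). For $0\le i\le m$, $t_i(\chi)$ is the least $t$ with $|\{\chi_1,\dots,\chi_t\}|=i$ ($t_0=0$), and $\tau_j(\chi)=t_{j+1}(\chi)-t_j(\chi)-1$. $\left\{{a\atop b}\right\}$ is the Stirling number of the second kind. -}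

module Defs where

open import Data.Bool using (Bool; true; false; not; if_then_else_)
open import Data.Nat using (ℕ; zero; suc; _+_; _*_; _∸_; _^_; _≡ᵇ_)
open import Data.Fin using (Fin)
import Data.Fin as Fin
open import Data.List using (List; []; _∷_; length; map; filter; take; reverse; deduplicate; applyUpTo; concatMap; allFin)
open import Data.Integer using (+_)
open import Data.Rational using (ℚ; _/_)
open import Data.Nat.ListAction using (sum)
open import Data.Bool.ListAction using (any)
open import Relation.Nullary.Decidable using (does)
open import Relation.Unary using (Decidable)
open import Relation.Binary.PropositionalEquality using (_≡_)

stirling2 : ℕ → ℕ → ℕ
stirling2 zero    zero    = 1
stirling2 zero    (suc b) = 0
stirling2 (suc a) zero    = 0
stirling2 (suc a) (suc b) = suc b * stirling2 a (suc b) + stirling2 a b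

-- all sequences of length ℓ in X = Fin n (each has probability n^-ℓ)
allSeqs : (n ℓ : ℕ) → List (List (Fin n))
allSeqs n zero    = [] ∷ []
allSeqs n (suc ℓ) = concatMap (λ x → map (x ∷_) (allSeqs n ℓ)) (allFin n)

card : {n : ℕ} → List (Fin n) → ℕ
card xs = length (deduplicate Fin._≟_ xs)

lastFresh : {n : ℕ} → List (Fin n) → Bool
lastFresh xs with reverse xs
... | []       = false
... | x ∷ rest = not (any (λ y → does (x Fin.≟ y)) rest)

inX : {n : ℕ} → ℕ → List (Fin n) → Bool
inX m xs = (card xs ≡ᵇ m) Data.Bool.∧ lastFresh xs

Xml : (n m ℓ : ℕ) → List (List (Fin n))
Xml n m ℓ = filter (λ xs → Data.Bool.T? (inX m xs)) (allSeqs n ℓ)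

firstWith : (ℕ → Bool) → List ℕ → ℕ
firstWith p []       = 0
firstWith p (t ∷ ts) = if p t then t else firstWith p ts

tIdx : {n : ℕ} → ℕ → List (Fin n) → ℕ
tIdx i xs = firstWith (λ t → card (take t xs) ≡ᵇ i) (applyUpTo (λ t → t) (suc (length xs)))

tau : {n : ℕ} → ℕ → List (Fin n) → ℕ
tau j xs = tIdx (suc j) xs ∸ tIdx j xs ∸ 1

-- a / d as a rational (d = 0 gives 0; never used with d = 0 below)
_/ℕ_ : ℕ → ℕ → ℚ
a /ℕ zero  = (+ 0) / 1
a /ℕ suc d = (+ a) / suc d

-- E_m[τ_j | 𝒳_m^(ℓ)] : uniform average of τ_j over 𝒳_m^(ℓ)
Etau : (n m ℓ j : ℕ) → ℚ
Etau n m ℓ j = sum (map (tau j) (Xml n m ℓ)) /ℕ length (Xml n m ℓ)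

rhsSum : (m ℓ j : ℕ) → ℕ
rhsSum m ℓ j = sum (map (λ k → j ^ k * stirling2 (ℓ ∸ k ∸ 1) (m ∸ 1)) (applyUpTo suc (ℓ ∸ m)))

module Submission where

-- Replace a sequence χ by its freshness pattern, the Boolean list whose t-th entry
-- says whether χ_t is a value not seen before.  The number of values, the indices
-- t_i (hence τ_j) and the condition "the last value is new" are all read off the
-- pattern.  Appending a letter y to χ appends "y is new", and when χ has c values
-- exactly n ∸ c of the n letters are new.  Hence sums of pattern statistics over
-- all n^ℓ sequences satisfy a one-step recursion in ℓ (patternSum-snoc).  For the
-- number of sequences with k values this is the Stirling recurrence, giving
-- (n)_k S(ℓ,k) (valueCount); for the total of τ_j it gives (n)_k T_j(ℓ,k), and
-- T_j(ℓ,k) = Σ_i j^{i+1} S(ℓ-1-i,k) for k ≥ j (gapCount, gapTotal≡powerSum).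
-- Both numerator and denominator of E_m[τ_j] then carry the falling factorial
-- (n)_m ≠ 0, which cancels.

open import Defs
open import Data.Bool using (Bool; true; false; not; _∧_; _∨_; if_then_else_)
open import Data.Bool.Properties using (∨-assoc; ∨-comm; ∨-identityʳ; ∧-zeroʳ; ∧-identityʳ; ⇔→≡; T-≡)
open import Data.Bool.ListAction using (any)
open import Data.Nat using (ℕ; zero; suc; _+_; _*_; _∸_; _^_; _≡ᵇ_; _≤_; _<_; z≤n; s≤s)
open import Data.Nat.Properties
open import Data.Nat.ListAction using (sum)
open import Data.Nat.ListAction.Properties using (sum-++)
open import Data.Nat.Tactic.RingSolver using (solve-∀)
open import Data.Fin using (Fin)
import Data.Fin as Fin
import Data.Fin.Properties as Fin
open import Data.List using (List; []; _∷_; _++_; _∷ʳ_; length; map; filter; concatMap; take; reverse; applyUpTo; allFin; deduplicate; initLast; _∷ʳ′_)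
open import Data.List.Properties using (map-++; map-cong; map-tabulate; ++-assoc; ++-identityʳ; unfold-reverse; reverse-++)
open import Data.List.Membership.Propositional using (_∈_)
open import Data.List.Membership.Propositional.Properties using (deduplicate-∈⇔)
open import Data.List.Relation.Unary.Any using (here; there)
open import Data.List.Relation.Unary.All using (All; []; _∷_)
open import Data.List.Relation.Unary.AllPairs using ([]; _∷_)
open import Data.List.Relation.Unary.Unique.Propositional using (Unique)
open import Data.List.Relation.Unary.Unique.DecPropositional.Properties using (deduplicate-!)
open import Data.Sum using (inj₁; inj₂)
open import Data.Integer using () renaming (+_ to ℤ⁺)
import Data.Integer.Properties as ℤ
open import Data.Rational.Unnormalised using (mkℚᵘ; *≡*)
open import Data.Rational.Properties using (fromℚᵘ-cong)
open import Function.Bundles using (_⇔_; mk⇔; Equivalence)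
import Function.Properties.Equivalence as ⇔
open import Relation.Nullary using (¬_)
open import Relation.Nullary.Decidable using (does; T?; yes; no; dec-true; dec-false; does-⇔)
open import Relation.Binary.PropositionalEquality
open ≡-Reasoning

𝟙 : Bool → ℕ
𝟙 true  = 1
𝟙 false = 0

∑ : {A : Set} → List A → (A → ℕ) → ℕ
∑ xs f = sum (map f xs)

∑-++ : {A : Set} (xs ys : List A) (f : A → ℕ) → ∑ (xs ++ ys) f ≡ ∑ xs f + ∑ ys f
∑-++ xs ys f = trans (cong sum (map-++ f xs ys)) (sum-++ (map f xs) (map f ys))

∑-cong : {A : Set} (xs : List A) {f g : A → ℕ} → (∀ x → f x ≡ g x) → ∑ xs f ≡ ∑ xs g
∑-cong xs f≗g = cong sum (map-cong f≗g xs)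

∑-map : {A B : Set} (xs : List A) (h : A → B) (f : B → ℕ) → ∑ (map h xs) f ≡ ∑ xs (λ x → f (h x))
∑-map []       h f = refl
∑-map (x ∷ xs) h f = cong (f (h x) +_) (∑-map xs h f)

∑-zero : {A : Set} (xs : List A) → ∑ xs (λ _ → 0) ≡ 0
∑-zero []       = refl
∑-zero (x ∷ xs) = ∑-zero xs

∑-+ : {A : Set} (xs : List A) (f g : A → ℕ) → ∑ xs (λ x → f x + g x) ≡ ∑ xs f + ∑ xs g
∑-+ []       f g = refl
∑-+ (x ∷ xs) f g = trans (cong (f x + g x +_) (∑-+ xs f g)) (interchange (f x) (g x) (∑ xs f) (∑ xs g))
  where
  interchange : ∀ a b c d → a + b + (c + d) ≡ a + c + (b + d)
  interchange = solve-∀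

∑-* : {A : Set} (xs : List A) (c : ℕ) (f : A → ℕ) → ∑ xs (λ x → c * f x) ≡ c * ∑ xs f
∑-* []       c f = sym (*-zeroʳ c)
∑-* (x ∷ xs) c f = trans (cong (c * f x +_) (∑-* xs c f)) (sym (*-distribˡ-+ c (f x) (∑ xs f)))

∑-concatMap : {A B : Set} (xs : List A) (g : A → List B) (f : B → ℕ) →
  ∑ (concatMap g xs) f ≡ ∑ xs (λ x → ∑ (g x) f)
∑-concatMap []       g f = refl
∑-concatMap (x ∷ xs) g f = trans (∑-++ (g x) (concatMap g xs) f) (cong (∑ (g x) f +_) (∑-concatMap xs g f))

∑-filter : {A : Set} (p : A → Bool) (h : A → ℕ) (xs : List A) →
  ∑ (filter (λ x → T? (p x)) xs) h ≡ ∑ xs (λ x → 𝟙 (p x) * h x)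
∑-filter p h []       = refl
∑-filter p h (x ∷ xs) with p x
... | true  = cong₂ _+_ (sym (+-identityʳ (h x))) (∑-filter p h xs)
... | false = ∑-filter p h xs

length-filter : {A : Set} (p : A → Bool) (xs : List A) →
  length (filter (λ x → T? (p x)) xs) ≡ ∑ xs (λ x → 𝟙 (p x))
length-filter p []       = refl
length-filter p (x ∷ xs) with p x
... | true  = cong suc (length-filter p xs)
... | false = length-filter p xs

∑-allFin-suc : (n : ℕ) (f : Fin (suc n) → ℕ) → ∑ (allFin (suc n)) f ≡ f Fin.zero + ∑ (allFin n) (λ x → f (Fin.suc x))
∑-allFin-suc n f = cong (f Fin.zero +_) (trans (cong (λ l → ∑ l f) (sym (map-tabulate (λ x → x) Fin.suc))) (∑-map (allFin n) Fin.suc f))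

∑-allFin-delta : (n : ℕ) (y : Fin n) (q : Fin n → Bool) → ∑ (allFin n) (λ x → 𝟙 (does (x Fin.≟ y) ∧ q x)) ≡ 𝟙 (q y)
∑-allFin-delta (suc n) Fin.zero q = begin
  ∑ (allFin (suc n)) (λ x → 𝟙 (does (x Fin.≟ Fin.zero) ∧ q x))   ≡⟨ ∑-allFin-suc n (λ x → 𝟙 (does (x Fin.≟ Fin.zero) ∧ q x)) ⟩
  𝟙 (q Fin.zero) + ∑ (allFin n) (λ _ → 0)                          ≡⟨ cong (𝟙 (q Fin.zero) +_) (∑-zero (allFin n)) ⟩
  𝟙 (q Fin.zero) + 0                                               ≡⟨ +-identityʳ _ ⟩
  𝟙 (q Fin.zero)                                                   ∎
∑-allFin-delta (suc n) (Fin.suc y) q = begin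
  ∑ (allFin (suc n)) (λ x → 𝟙 (does (x Fin.≟ Fin.suc y) ∧ q x))                     ≡⟨ ∑-allFin-suc n (λ x → 𝟙 (does (x Fin.≟ Fin.suc y) ∧ q x)) ⟩
  ∑ (allFin n) (λ x → 𝟙 (does (Fin.suc x Fin.≟ Fin.suc y) ∧ q (Fin.suc x)))          ≡⟨ ∑-cong (allFin n) (λ x → cong (λ b → 𝟙 (b ∧ q (Fin.suc x))) (suc-≟ x)) ⟩
  ∑ (allFin n) (λ x → 𝟙 (does (x Fin.≟ y) ∧ q (Fin.suc x)))                          ≡⟨ ∑-allFin-delta n y (λ x → q (Fin.suc x)) ⟩
  𝟙 (q (Fin.suc y))                                                                 ∎
  where
  suc-≟ : ∀ x → does (Fin.suc x Fin.≟ Fin.suc y) ≡ does (x Fin.≟ y)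
  suc-≟ x = does-⇔ (mk⇔ Fin.suc-injective (cong Fin.suc)) (Fin.suc x Fin.≟ Fin.suc y) (x Fin.≟ y)

∑-allFin-one : (n : ℕ) → ∑ (allFin n) (λ _ → 1) ≡ n
∑-allFin-one zero    = refl
∑-allFin-one (suc n) = trans (∑-allFin-suc n (λ _ → 1)) (cong suc (∑-allFin-one n))

-- Boolean membership, written exactly as in Defs.lastFresh.
_∈ᵇ_ : {n : ℕ} → Fin n → List (Fin n) → Bool
x ∈ᵇ L = any (λ y → does (x Fin.≟ y)) L

∈ᵇ-++ : {n : ℕ} (x : Fin n) (L M : List (Fin n)) → x ∈ᵇ (L ++ M) ≡ (x ∈ᵇ L ∨ x ∈ᵇ M)
∈ᵇ-++ x []      M = refl
∈ᵇ-++ x (y ∷ L) M = trans (cong (does (x Fin.≟ y) ∨_) (∈ᵇ-++ x L M)) (sym (∨-assoc (does (x Fin.≟ y)) (x ∈ᵇ L) (x ∈ᵇ M)))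

∈ᵇ⇔∈ : {n : ℕ} {x : Fin n} {L : List (Fin n)} → (x ∈ᵇ L ≡ true) ⇔ x ∈ L
∈ᵇ⇔∈ = mk⇔ (to _ _) (from _ _)
  where
  to : {n : ℕ} (x : Fin n) (L : List (Fin n)) → x ∈ᵇ L ≡ true → x ∈ L
  to x (y ∷ L) eq with x Fin.≟ y
  ... | yes x≡y = here x≡y
  ... | no  _   = there (to x L eq)
  from : {n : ℕ} (x : Fin n) (L : List (Fin n)) → x ∈ L → x ∈ᵇ L ≡ true
  from x (y ∷ L) (here x≡y)  rewrite dec-true (x Fin.≟ y) x≡y = refl
  from x (y ∷ L) (there x∈L) rewrite from x L x∈L = ∨-comm _ true

∈ᵇ-deduplicate : {n : ℕ} (x : Fin n) (L : List (Fin n)) → x ∈ᵇ deduplicate Fin._≟_ L ≡ x ∈ᵇ L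
∈ᵇ-deduplicate x L =
  ⇔→≡ (⇔.trans (∈ᵇ⇔∈ {L = deduplicate Fin._≟_ L}) (⇔.trans (⇔.sym (deduplicate-∈⇔ Fin._≟_ {L})) (⇔.sym (∈ᵇ⇔∈ {x = x}))))

∉⇒∈ᵇ-false : {n : ℕ} (x : Fin n) (L : List (Fin n)) → All (λ y → ¬ x ≡ y) L → x ∈ᵇ L ≡ false
∉⇒∈ᵇ-false x []      []           = refl
∉⇒∈ᵇ-false x (y ∷ L) (x≢y ∷ x∉L) rewrite dec-false (x Fin.≟ y) x≢y = ∉⇒∈ᵇ-false x L x∉L

∈ᵇ-reverse : {n : ℕ} (x : Fin n) (L : List (Fin n)) → x ∈ᵇ reverse L ≡ x ∈ᵇ L
∈ᵇ-reverse x []      = refl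
∈ᵇ-reverse x (y ∷ L) = begin
  x ∈ᵇ reverse (y ∷ L)                 ≡⟨ cong (x ∈ᵇ_) (unfold-reverse y L) ⟩
  x ∈ᵇ (reverse L ∷ʳ y)                ≡⟨ ∈ᵇ-++ x (reverse L) (y ∷ []) ⟩
  x ∈ᵇ reverse L ∨ (does (x Fin.≟ y) ∨ false) ≡⟨ cong₂ _∨_ (∈ᵇ-reverse x L) (∨-identityʳ _) ⟩
  x ∈ᵇ L ∨ does (x Fin.≟ y)            ≡⟨ ∨-comm (x ∈ᵇ L) _ ⟩
  x ∈ᵇ (y ∷ L)                         ∎

-- The number of points of Fin n that occur in L; it equals card L (card≡occurring)
-- but, unlike deduplication, it is easy to update when L grows.
occurring : {n : ℕ} → List (Fin n) → ℕ
occurring {n} L = ∑ (allFin n) (λ x → 𝟙 (x ∈ᵇ L))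

𝟙-split : (g : Bool → ℕ) (b : Bool) → g b ≡ g true * 𝟙 b + g false * 𝟙 (not b)
𝟙-split g true  = affine (g true) (g false)
  where
  affine : ∀ a c → a ≡ a * 1 + c * 0
  affine = solve-∀
𝟙-split g false = affine (g true) (g false)
  where
  affine : ∀ a c → c ≡ a * 0 + c * 1
  affine = solve-∀

∑-fresh : {n : ℕ} (L : List (Fin n)) → ∑ (allFin n) (λ x → 𝟙 (not (x ∈ᵇ L))) ≡ n ∸ occurring L
∑-fresh {n} L = begin
  newPoints                                        ≡⟨ sym (m+n∸m≡n (occurring L) newPoints) ⟩
  occurring L + newPoints ∸ occurring L            ≡⟨ cong (_∸ occurring L) (sym (∑-+ (allFin n) _ _)) ⟩
  ∑ (allFin n) (λ x → 𝟙 (x ∈ᵇ L) + 𝟙 (not (x ∈ᵇ L))) ∸ occurring L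
                                                   ≡⟨ cong (_∸ occurring L) (∑-cong (allFin n) (λ x → 𝟙-complement (x ∈ᵇ L))) ⟩
  ∑ (allFin n) (λ _ → 1) ∸ occurring L             ≡⟨ cong (_∸ occurring L) (∑-allFin-one n) ⟩
  n ∸ occurring L                                  ∎
  where
  newPoints = ∑ (allFin n) (λ x → 𝟙 (not (x ∈ᵇ L)))
  𝟙-complement : (b : Bool) → 𝟙 b + 𝟙 (not b) ≡ 1
  𝟙-complement true  = refl
  𝟙-complement false = refl

∑-membership : {n : ℕ} (L : List (Fin n)) (g : Bool → ℕ) →
  ∑ (allFin n) (λ y → g (y ∈ᵇ L)) ≡ occurring L * g true + (n ∸ occurring L) * g false
∑-membership {n} L g = begin
  ∑ (allFin n) (λ y → g (y ∈ᵇ L))                                       ≡⟨ ∑-cong (allFin n) (λ y → 𝟙-split g (y ∈ᵇ L)) ⟩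
  ∑ (allFin n) (λ y → g true * 𝟙 (y ∈ᵇ L) + g false * 𝟙 (not (y ∈ᵇ L))) ≡⟨ ∑-+ (allFin n) _ _ ⟩
  _                                                                     ≡⟨ cong₂ _+_ (∑-* (allFin n) (g true) _) (∑-* (allFin n) (g false) _) ⟩
  g true * occurring L + g false * ∑ (allFin n) (λ y → 𝟙 (not (y ∈ᵇ L))) ≡⟨ cong (λ k → g true * occurring L + g false * k) (∑-fresh L) ⟩
  g true * occurring L + g false * (n ∸ occurring L)                    ≡⟨ cong₂ _+_ (*-comm (g true) _) (*-comm (g false) _) ⟩
  occurring L * g true + (n ∸ occurring L) * g false                    ∎

occurring-extend : {n : ℕ} (L : List (Fin n)) (y : Fin n) →
  ∑ (allFin n) (λ x → 𝟙 (x ∈ᵇ L ∨ does (x Fin.≟ y))) ≡ occurring L + 𝟙 (not (y ∈ᵇ L))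
occurring-extend {n} L y = begin
  ∑ (allFin n) (λ x → 𝟙 (x ∈ᵇ L ∨ does (x Fin.≟ y)))                        ≡⟨ ∑-cong (allFin n) (λ x → 𝟙-∨ (x ∈ᵇ L) (does (x Fin.≟ y))) ⟩
  ∑ (allFin n) (λ x → 𝟙 (x ∈ᵇ L) + 𝟙 (does (x Fin.≟ y) ∧ not (x ∈ᵇ L)))     ≡⟨ ∑-+ (allFin n) _ _ ⟩
  occurring L + ∑ (allFin n) (λ x → 𝟙 (does (x Fin.≟ y) ∧ not (x ∈ᵇ L)))   ≡⟨ cong (occurring L +_) (∑-allFin-delta n y (λ x → not (x ∈ᵇ L))) ⟩
  occurring L + 𝟙 (not (y ∈ᵇ L))                                            ∎
  where
  𝟙-∨ : (a d : Bool) → 𝟙 (a ∨ d) ≡ 𝟙 a + 𝟙 (d ∧ not a)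
  𝟙-∨ true  true  = refl
  𝟙-∨ true  false = refl
  𝟙-∨ false true  = refl
  𝟙-∨ false false = refl

occurring-snoc : {n : ℕ} (L : List (Fin n)) (y : Fin n) → occurring (L ∷ʳ y) ≡ occurring L + 𝟙 (not (y ∈ᵇ L))
occurring-snoc {n} L y = trans (∑-cong (allFin n) (λ x → cong 𝟙 (∈ᵇ-snoc x))) (occurring-extend L y)
  where
  ∈ᵇ-snoc : ∀ x → x ∈ᵇ (L ∷ʳ y) ≡ (x ∈ᵇ L ∨ does (x Fin.≟ y))
  ∈ᵇ-snoc x = trans (∈ᵇ-++ x L (y ∷ [])) (cong (x ∈ᵇ L ∨_) (∨-identityʳ _))

unique⇒length≡occurring : {n : ℕ} (U : List (Fin n)) → Unique U → length U ≡ occurring U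
unique⇒length≡occurring {n} []      []          = sym (∑-zero (allFin n))
unique⇒length≡occurring {n} (u ∷ U) (u∉U ∷ !U) = sym (begin
  occurring (u ∷ U)                            ≡⟨ ∑-cong (allFin n) (λ x → cong 𝟙 (∨-comm (does (x Fin.≟ u)) (x ∈ᵇ U))) ⟩
  ∑ (allFin n) (λ x → 𝟙 (x ∈ᵇ U ∨ does (x Fin.≟ u))) ≡⟨ occurring-extend U u ⟩
  occurring U + 𝟙 (not (u ∈ᵇ U))               ≡⟨ cong (λ b → occurring U + 𝟙 (not b)) (∉⇒∈ᵇ-false u U u∉U) ⟩
  occurring U + 1                              ≡⟨ +-comm (occurring U) 1 ⟩
  suc (occurring U)                            ≡⟨ cong suc (sym (unique⇒length≡occurring U !U)) ⟩
  suc (length U)                               ∎)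

card≡occurring : {n : ℕ} (L : List (Fin n)) → card L ≡ occurring L
card≡occurring {n} L = trans (unique⇒length≡occurring _ (deduplicate-! Fin._≟_ L))
                             (∑-cong (allFin n) (λ x → cong 𝟙 (∈ᵇ-deduplicate x L)))

trues : List Bool → ℕ
trues b = ∑ b 𝟙

trues-snoc-true : (b : List Bool) → trues (b ∷ʳ true) ≡ suc (trues b)
trues-snoc-true []      = refl
trues-snoc-true (x ∷ b) = trans (cong (𝟙 x +_) (trues-snoc-true b)) (+-suc (𝟙 x) (trues b))

trues-snoc-false : (b : List Bool) → trues (b ∷ʳ false) ≡ trues b
trues-snoc-false []      = refl
trues-snoc-false (x ∷ b) = cong (𝟙 x +_) (trues-snoc-false b)

fresh : {n : ℕ} → List (Fin n) → List (Fin n) → List Bool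
fresh L []       = []
fresh L (y ∷ ys) = not (y ∈ᵇ L) ∷ fresh (L ∷ʳ y) ys

freshness : {n : ℕ} → List (Fin n) → List Bool
freshness xs = fresh [] xs

fresh-length : {n : ℕ} (L xs : List (Fin n)) → length (fresh L xs) ≡ length xs
fresh-length L []       = refl
fresh-length L (x ∷ xs) = cong suc (fresh-length (L ∷ʳ x) xs)

fresh-take : {n : ℕ} (t : ℕ) (L xs : List (Fin n)) → take t (fresh L xs) ≡ fresh L (take t xs)
fresh-take zero    L xs       = refl
fresh-take (suc t) L []       = refl
fresh-take (suc t) L (x ∷ xs) = cong (not (x ∈ᵇ L) ∷_) (fresh-take t (L ∷ʳ x) xs)

fresh-snoc : {n : ℕ} (L ys : List (Fin n)) (y : Fin n) → fresh L (ys ∷ʳ y) ≡ fresh L ys ∷ʳ not (y ∈ᵇ (L ++ ys))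
fresh-snoc L []       y = cong (λ M → not (y ∈ᵇ M) ∷ []) (sym (++-identityʳ L))
fresh-snoc L (x ∷ ys) y = cong (not (x ∈ᵇ L) ∷_)
  (trans (fresh-snoc (L ∷ʳ x) ys y) (cong (λ M → fresh (L ∷ʳ x) ys ∷ʳ not (y ∈ᵇ M)) (++-assoc L (x ∷ []) ys)))

occurring-fresh : {n : ℕ} (L ys : List (Fin n)) → occurring L + trues (fresh L ys) ≡ occurring (L ++ ys)
occurring-fresh L []       = trans (+-identityʳ _) (cong occurring (sym (++-identityʳ L)))
occurring-fresh L (y ∷ ys) = begin
  occurring L + (𝟙 (not (y ∈ᵇ L)) + trues (fresh (L ∷ʳ y) ys)) ≡⟨ sym (+-assoc (occurring L) _ _) ⟩
  occurring L + 𝟙 (not (y ∈ᵇ L)) + trues (fresh (L ∷ʳ y) ys)   ≡⟨ cong (_+ trues (fresh (L ∷ʳ y) ys)) (sym (occurring-snoc L y)) ⟩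
  occurring (L ∷ʳ y) + trues (fresh (L ∷ʳ y) ys)               ≡⟨ occurring-fresh (L ∷ʳ y) ys ⟩
  occurring ((L ∷ʳ y) ++ ys)                                   ≡⟨ cong occurring (++-assoc L (y ∷ []) ys) ⟩
  occurring (L ++ y ∷ ys)                                      ∎

occurring≡trues : {n : ℕ} (xs : List (Fin n)) → occurring xs ≡ trues (freshness xs)
occurring≡trues {n} xs = trans (sym (occurring-fresh [] xs)) (cong (_+ trues (freshness xs)) (∑-zero (allFin n)))

card≡trues : {n : ℕ} (xs : List (Fin n)) → card xs ≡ trues (freshness xs)
card≡trues xs = trans (card≡occurring xs) (occurring≡trues xs)

firstIndex : ℕ → List Bool → ℕ
firstIndex i b = firstWith (λ t → trues (take t b) ≡ᵇ i) (applyUpTo (λ t → t) (suc (length b)))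

tauP : ℕ → List Bool → ℕ
tauP j b = firstIndex (suc j) b ∸ firstIndex j b ∸ 1

firstWith-cong : (p q : ℕ → Bool) → (∀ t → p t ≡ q t) → (ts : List ℕ) → firstWith p ts ≡ firstWith q ts
firstWith-cong p q p≗q []       = refl
firstWith-cong p q p≗q (t ∷ ts) rewrite p≗q t = cong (λ r → if q t then t else r) (firstWith-cong p q p≗q ts)

tIdx≡firstIndex : {n : ℕ} (i : ℕ) (xs : List (Fin n)) → tIdx i xs ≡ firstIndex i (freshness xs)
tIdx≡firstIndex i xs = begin
  firstWith (λ t → card (take t xs) ≡ᵇ i) (range (length xs))
    ≡⟨ firstWith-cong _ _ (λ t → cong (_≡ᵇ i) (card-take t)) (range (length xs)) ⟩
  firstWith (λ t → trues (take t (freshness xs)) ≡ᵇ i) (range (length xs))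
    ≡⟨ cong (λ k → firstWith (λ t → trues (take t (freshness xs)) ≡ᵇ i) (range k)) (sym (fresh-length [] xs)) ⟩
  firstIndex i (freshness xs) ∎
  where
  range : ℕ → List ℕ
  range k = applyUpTo (λ t → t) (suc k)
  card-take : ∀ t → card (take t xs) ≡ trues (take t (freshness xs))
  card-take t = trans (card≡trues (take t xs)) (cong trues (sym (fresh-take t [] xs)))

tau≡tauP : {n : ℕ} (j : ℕ) (xs : List (Fin n)) → tau j xs ≡ tauP j (freshness xs)
tau≡tauP j xs = cong₂ (λ a b → a ∸ b ∸ 1) (tIdx≡firstIndex (suc j) xs) (tIdx≡firstIndex j xs)

lastB : List Bool → Bool
lastB []          = false
lastB (x ∷ [])    = x
lastB (x ∷ y ∷ b) = lastB (y ∷ b)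

lastB-snoc : (b : List Bool) (x : Bool) → lastB (b ∷ʳ x) ≡ x
lastB-snoc []          x = refl
lastB-snoc (y ∷ [])    x = refl
lastB-snoc (y ∷ z ∷ b) x = lastB-snoc (z ∷ b) x

headFresh : {n : ℕ} → List (Fin n) → Bool
headFresh []         = false
headFresh (x ∷ rest) = not (x ∈ᵇ rest)

lastFresh≡headFresh : {n : ℕ} (xs : List (Fin n)) → lastFresh xs ≡ headFresh (reverse xs)
lastFresh≡headFresh xs with reverse xs
... | []       = refl
... | x ∷ rest = refl

lastFresh≡lastB : {n : ℕ} (xs : List (Fin n)) → lastFresh xs ≡ lastB (freshness xs)
lastFresh≡lastB xs with initLast xs
... | []         = refl
... | ys ∷ʳ′ y = begin
  lastFresh (ys ∷ʳ y)                      ≡⟨ lastFresh≡headFresh (ys ∷ʳ y) ⟩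
  headFresh (reverse (ys ∷ʳ y))            ≡⟨ cong headFresh (reverse-++ ys (y ∷ [])) ⟩
  not (y ∈ᵇ reverse ys)                    ≡⟨ cong not (∈ᵇ-reverse y ys) ⟩
  not (y ∈ᵇ ys)                            ≡⟨ sym (lastB-snoc (freshness ys) _) ⟩
  lastB (freshness ys ∷ʳ not (y ∈ᵇ ys))    ≡⟨ cong lastB (sym (fresh-snoc [] ys y)) ⟩
  lastB (freshness (ys ∷ʳ y))              ∎

endsFresh : ℕ → List Bool → Bool
endsFresh m b = (trues b ≡ᵇ m) ∧ lastB b

inX≡endsFresh : {n : ℕ} (m : ℕ) (xs : List (Fin n)) → inX m xs ≡ endsFresh m (freshness xs)
inX≡endsFresh m xs = cong₂ (λ c l → (c ≡ᵇ m) ∧ l) (card≡trues xs) (lastFresh≡lastB xs)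

pos : ℕ → List Bool → ℕ
pos zero    b           = 0
pos (suc i) []          = 0
pos (suc i) (true ∷ b)  = suc (pos i b)
pos (suc i) (false ∷ b) = suc (pos (suc i) b)

-- gapFrom j b: the number of `false` entries between the j-th and the (j+1)-th
-- `true` of b (the 0-th `true` being the start of b); this is τ_j in pattern form.
gapFrom : ℕ → List Bool → ℕ
gapFrom j       []          = 0
gapFrom zero    (true ∷ b)  = 0
gapFrom zero    (false ∷ b) = suc (gapFrom zero b)
gapFrom (suc j) (true ∷ b)  = gapFrom j b
gapFrom (suc j) (false ∷ b) = gapFrom (suc j) b

any-shift : (p : ℕ → Bool) (f : ℕ → ℕ) (N : ℕ) →
  any p (applyUpTo (λ t → suc (f t)) N) ≡ any (λ t → p (suc t)) (applyUpTo f N)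
any-shift p f zero    = refl
any-shift p f (suc N) = cong (p (suc (f 0)) ∨_) (any-shift p (λ t → f (suc t)) N)

firstWith-shift : (p : ℕ → Bool) (f : ℕ → ℕ) (N : ℕ) → any (λ t → p (suc t)) (applyUpTo f N) ≡ true →
  firstWith p (applyUpTo (λ t → suc (f t)) N) ≡ suc (firstWith (λ t → p (suc t)) (applyUpTo f N))
firstWith-shift p f (suc N) hit with p (suc (f 0))
... | true  = refl
... | false = firstWith-shift p (λ t → f (suc t)) N hit

reached : (i : ℕ) (b : List Bool) → i ≤ trues b →
  any (λ t → trues (take t b) ≡ᵇ i) (applyUpTo (λ t → t) (suc (length b))) ≡ true
reached zero    b           _        = refl
reached (suc i) (true ∷ b)  (s≤s le) = trans (any-shift (λ t → trues (take t (true ∷ b)) ≡ᵇ suc i) (λ t → t) (suc (length b))) (reached i b le)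
reached (suc i) (false ∷ b) le       = trans (any-shift (λ t → trues (take t (false ∷ b)) ≡ᵇ suc i) (λ t → t) (suc (length b))) (reached (suc i) b le)

firstIndex≡pos : (i : ℕ) (b : List Bool) → i ≤ trues b → firstIndex i b ≡ pos i b
firstIndex≡pos zero    b           _        = refl
firstIndex≡pos (suc i) (true ∷ b)  (s≤s le) =
  trans (firstWith-shift (λ t → trues (take t (true ∷ b)) ≡ᵇ suc i) (λ t → t) (suc (length b)) (reached i b le)) (cong suc (firstIndex≡pos i b le))
firstIndex≡pos (suc i) (false ∷ b) le       =
  trans (firstWith-shift (λ t → trues (take t (false ∷ b)) ≡ᵇ suc i) (λ t → t) (suc (length b)) (reached (suc i) b le)) (cong suc (firstIndex≡pos (suc i) b le))

pos-one : (b : List Bool) → 1 ≤ trues b → pos 1 b ≡ suc (gapFrom zero b)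
pos-one (true ∷ b)  _  = refl
pos-one (false ∷ b) le = cong suc (pos-one b le)

pos-gap : (j : ℕ) (b : List Bool) → suc j ≤ trues b → pos (suc j) b ∸ pos j b ∸ 1 ≡ gapFrom j b
pos-gap zero    b           le       = cong (_∸ 1) (pos-one b le)
pos-gap (suc j) (true ∷ b)  (s≤s le) = pos-gap j b le
pos-gap (suc j) (false ∷ b) le       = pos-gap (suc j) b le

tauP≡gapFrom : (j : ℕ) (b : List Bool) → suc j ≤ trues b → tauP j b ≡ gapFrom j b
tauP≡gapFrom j b le = trans (cong₂ (λ x y → x ∸ y ∸ 1) (firstIndex≡pos (suc j) b le) (firstIndex≡pos j b (≤-trans (n≤1+n j) le)))
                            (pos-gap j b le)

gapFrom-snoc : (j : ℕ) (b : List Bool) (x : Bool) → gapFrom j (b ∷ʳ x) ≡ gapFrom j b + 𝟙 ((trues b ≡ᵇ j) ∧ not x)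
gapFrom-snoc zero    []          true  = refl
gapFrom-snoc zero    []          false = refl
gapFrom-snoc (suc j) []          true  = refl
gapFrom-snoc (suc j) []          false = refl
gapFrom-snoc zero    (true ∷ b)  x     = refl
gapFrom-snoc zero    (false ∷ b) x     = cong suc (gapFrom-snoc zero b x)
gapFrom-snoc (suc j) (true ∷ b)  x     = gapFrom-snoc j b x
gapFrom-snoc (suc j) (false ∷ b) x     = gapFrom-snoc (suc j) b x

gapFrom-new : (j : ℕ) (b : List Bool) → gapFrom j (b ∷ʳ true) ≡ gapFrom j b
gapFrom-new j b = trans (gapFrom-snoc j b true) (trans (cong (λ c → gapFrom j b + 𝟙 c) (∧-zeroʳ _)) (+-identityʳ _))

gapFrom-old : (j : ℕ) (b : List Bool) → gapFrom j (b ∷ʳ false) ≡ gapFrom j b + 𝟙 (trues b ≡ᵇ j)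
gapFrom-old j b = trans (gapFrom-snoc j b false) (cong (λ c → gapFrom j b + 𝟙 c) (∧-identityʳ _))

allSeqs-cons : (n ℓ : ℕ) (f : List (Fin n) → ℕ) →
  ∑ (allSeqs n (suc ℓ)) f ≡ ∑ (allFin n) (λ x → ∑ (allSeqs n ℓ) (λ xs → f (x ∷ xs)))
allSeqs-cons n ℓ f = trans (∑-concatMap (allFin n) (λ x → map (x ∷_) (allSeqs n ℓ)) f)
                           (∑-cong (allFin n) (λ x → ∑-map (allSeqs n ℓ) (x ∷_) f))

allSeqs-snoc : (n ℓ : ℕ) (f : List (Fin n) → ℕ) →
  ∑ (allSeqs n (suc ℓ)) f ≡ ∑ (allSeqs n ℓ) (λ xs → ∑ (allFin n) (λ y → f (xs ∷ʳ y)))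
allSeqs-snoc n zero    f = trans (allSeqs-cons n 0 f)
  (trans (∑-cong (allFin n) (λ x → +-identityʳ (f (x ∷ [])))) (sym (+-identityʳ _)))
allSeqs-snoc n (suc ℓ) f = begin
  ∑ (allSeqs n (suc (suc ℓ))) f                                                  ≡⟨ allSeqs-cons n (suc ℓ) f ⟩
  ∑ (allFin n) (λ x → ∑ (allSeqs n (suc ℓ)) (λ xs → f (x ∷ xs)))                 ≡⟨ ∑-cong (allFin n) (λ x → allSeqs-snoc n ℓ (λ xs → f (x ∷ xs))) ⟩
  ∑ (allFin n) (λ x → ∑ (allSeqs n ℓ) (λ xs → ∑ (allFin n) (λ y → f (x ∷ xs ∷ʳ y)))) ≡⟨ sym (allSeqs-cons n ℓ (λ zs → ∑ (allFin n) (λ y → f (zs ∷ʳ y)))) ⟩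
  ∑ (allSeqs n (suc ℓ)) (λ zs → ∑ (allFin n) (λ y → f (zs ∷ʳ y)))                ∎

patternSum : (n ℓ : ℕ) → (List Bool → ℕ) → ℕ
patternSum n ℓ F = ∑ (allSeqs n ℓ) (λ xs → F (freshness xs))

-- The key recursion: a pattern p with trues p new values extends by an old value
-- in trues p ways and by a new value in n ∸ trues p ways.
patternSum-snoc : (n ℓ : ℕ) (F : List Bool → ℕ) →
  patternSum n (suc ℓ) F ≡ patternSum n ℓ (λ p → trues p * F (p ∷ʳ false) + (n ∸ trues p) * F (p ∷ʳ true))
patternSum-snoc n ℓ F = trans (allSeqs-snoc n ℓ (λ xs → F (freshness xs))) (∑-cong (allSeqs n ℓ) extend)
  where
  extend : ∀ xs → ∑ (allFin n) (λ y → F (freshness (xs ∷ʳ y))) ≡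
                  trues (freshness xs) * F (freshness xs ∷ʳ false) + (n ∸ trues (freshness xs)) * F (freshness xs ∷ʳ true)
  extend xs = begin
    ∑ (allFin n) (λ y → F (freshness (xs ∷ʳ y)))                   ≡⟨ ∑-cong (allFin n) (λ y → cong F (fresh-snoc [] xs y)) ⟩
    ∑ (allFin n) (λ y → F (freshness xs ∷ʳ not (y ∈ᵇ xs)))         ≡⟨ ∑-membership xs (λ b → F (freshness xs ∷ʳ not b)) ⟩
    occurring xs * F (freshness xs ∷ʳ false) + (n ∸ occurring xs) * F (freshness xs ∷ʳ true)
                                                                   ≡⟨ cong (λ c → c * F (freshness xs ∷ʳ false) + (n ∸ c) * F (freshness xs ∷ʳ true)) (occurring≡trues xs) ⟩
    trues (freshness xs) * F (freshness xs ∷ʳ false) + (n ∸ trues (freshness xs)) * F (freshness xs ∷ʳ true) ∎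

valueSum : (n ℓ k : ℕ) → (List Bool → ℕ) → ℕ
valueSum n ℓ k H = patternSum n ℓ (λ p → 𝟙 (trues p ≡ᵇ k) * H p)

indicator-subst : (f : ℕ → ℕ) (c k h : ℕ) → f c * (𝟙 (c ≡ᵇ k) * h) ≡ f k * (𝟙 (c ≡ᵇ k) * h)
indicator-subst f zero    zero    h = refl
indicator-subst f zero    (suc k) h = trans (*-zeroʳ (f 0)) (sym (*-zeroʳ (f (suc k))))
indicator-subst f (suc c) zero    h = trans (*-zeroʳ (f (suc c))) (sym (*-zeroʳ (f 0)))
indicator-subst f (suc c) (suc k) h = indicator-subst (λ x → f (suc x)) c k h

valueSum-cong : (n ℓ k : ℕ) {H G : List Bool → ℕ} → (∀ p → H p ≡ G p) → valueSum n ℓ k H ≡ valueSum n ℓ k G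
valueSum-cong n ℓ k H≗G = ∑-cong (allSeqs n ℓ) (λ xs → cong (𝟙 (trues (freshness xs) ≡ᵇ k) *_) (H≗G (freshness xs)))

valueSum-+ : (n ℓ k : ℕ) (H G : List Bool → ℕ) → valueSum n ℓ k (λ p → H p + G p) ≡ valueSum n ℓ k H + valueSum n ℓ k G
valueSum-+ n ℓ k H G = trans (∑-cong (allSeqs n ℓ) (λ xs → *-distribˡ-+ (𝟙 (trues (freshness xs) ≡ᵇ k)) _ _)) (∑-+ (allSeqs n ℓ) _ _)

valueSum-of-trues : (n ℓ k : ℕ) (f : ℕ → ℕ) → valueSum n ℓ k (λ p → f (trues p)) ≡ f k * valueSum n ℓ k (λ _ → 1)
valueSum-of-trues n ℓ k f = trans (∑-cong (allSeqs n ℓ) (λ xs → pointwise (trues (freshness xs)))) (∑-* (allSeqs n ℓ) (f k) _)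
  where
  pointwise : ∀ c → 𝟙 (c ≡ᵇ k) * f c ≡ f k * (𝟙 (c ≡ᵇ k) * 1)
  pointwise c = trans (trans (*-comm (𝟙 (c ≡ᵇ k)) (f c)) (cong (f c *_) (sym (*-identityʳ _)))) (indicator-subst f c k 1)

-- A nonempty sequence has at least one value.
valueSum-zero : (n ℓ : ℕ) (H : List Bool → ℕ) → valueSum n (suc ℓ) 0 H ≡ 0
valueSum-zero n ℓ H = trans (patternSum-snoc n ℓ (λ p → 𝟙 (trues p ≡ᵇ 0) * H p)) (trans (∑-cong (allSeqs n ℓ) (λ xs → pointwise (freshness xs))) (∑-zero (allSeqs n ℓ)))
  where
  pointwise : ∀ p → trues p * (𝟙 (trues (p ∷ʳ false) ≡ᵇ 0) * H (p ∷ʳ false)) + (n ∸ trues p) * (𝟙 (trues (p ∷ʳ true) ≡ᵇ 0) * H (p ∷ʳ true)) ≡ 0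
  pointwise p rewrite trues-snoc-false p | trues-snoc-true p | *-zeroʳ (n ∸ trues p) | +-identityʳ (trues p * (𝟙 (trues p ≡ᵇ 0) * H (p ∷ʳ false))) =
    indicator-subst (λ c → c) (trues p) 0 (H (p ∷ʳ false))

-- Sequences with k+1 values arise from those with k values by a new letter
-- (n ∸ k choices) and from those with k+1 values by an old letter (k+1 choices).
valueSum-step : (n ℓ k : ℕ) (H : List Bool → ℕ) →
  valueSum n (suc ℓ) (suc k) H ≡ (n ∸ k) * valueSum n ℓ k (λ p → H (p ∷ʳ true)) + suc k * valueSum n ℓ (suc k) (λ p → H (p ∷ʳ false))
valueSum-step n ℓ k H = begin
  valueSum n (suc ℓ) (suc k) H                               ≡⟨ patternSum-snoc n ℓ (λ p → 𝟙 (trues p ≡ᵇ suc k) * H p) ⟩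
  ∑ (allSeqs n ℓ) (λ xs → step (freshness xs))               ≡⟨ ∑-cong (allSeqs n ℓ) (λ xs → pointwise (freshness xs)) ⟩
  ∑ (allSeqs n ℓ) (λ xs → (n ∸ k) * new (freshness xs) + suc k * old (freshness xs)) ≡⟨ ∑-+ (allSeqs n ℓ) _ _ ⟩
  _                                                          ≡⟨ cong₂ _+_ (∑-* (allSeqs n ℓ) (n ∸ k) _) (∑-* (allSeqs n ℓ) (suc k) _) ⟩
  (n ∸ k) * valueSum n ℓ k (λ p → H (p ∷ʳ true)) + suc k * valueSum n ℓ (suc k) (λ p → H (p ∷ʳ false)) ∎
  where
  new old step : List Bool → ℕ
  new p  = 𝟙 (trues p ≡ᵇ k) * H (p ∷ʳ true)
  old p  = 𝟙 (trues p ≡ᵇ suc k) * H (p ∷ʳ false)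
  step p = trues p * (𝟙 (trues (p ∷ʳ false) ≡ᵇ suc k) * H (p ∷ʳ false)) + (n ∸ trues p) * (𝟙 (trues (p ∷ʳ true) ≡ᵇ suc k) * H (p ∷ʳ true))
  pointwise : ∀ p → step p ≡ (n ∸ k) * new p + suc k * old p
  pointwise p rewrite trues-snoc-false p | trues-snoc-true p =
    trans (cong₂ _+_ (indicator-subst (λ c → c) (trues p) (suc k) _) (indicator-subst (n ∸_) (trues p) k _))
          (+-comm (suc k * old p) _)

falling : ℕ → ℕ → ℕ
falling n zero    = 1
falling n (suc k) = falling n k * (n ∸ k)

valueCount : (n ℓ k : ℕ) → valueSum n ℓ k (λ _ → 1) ≡ falling n k * stirling2 ℓ k
valueCount n zero    zero    = refl
valueCount n zero    (suc k) = sym (*-zeroʳ (falling n (suc k)))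
valueCount n (suc ℓ) zero    = valueSum-zero n ℓ (λ _ → 1)
valueCount n (suc ℓ) (suc k) = begin
  valueSum n (suc ℓ) (suc k) (λ _ → 1)                                           ≡⟨ valueSum-step n ℓ k (λ _ → 1) ⟩
  (n ∸ k) * valueSum n ℓ k (λ _ → 1) + suc k * valueSum n ℓ (suc k) (λ _ → 1)    ≡⟨ cong₂ (λ a b → (n ∸ k) * a + suc k * b) (valueCount n ℓ k) (valueCount n ℓ (suc k)) ⟩
  (n ∸ k) * (falling n k * stirling2 ℓ k) + suc k * (falling n k * (n ∸ k) * stirling2 ℓ (suc k))
                                                                                 ≡⟨ stirling-step (n ∸ k) (falling n k) (suc k) (stirling2 ℓ k) (stirling2 ℓ (suc k)) ⟩
  falling n k * (n ∸ k) * (suc k * stirling2 ℓ (suc k) + stirling2 ℓ k)          ∎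
  where
  stirling-step : ∀ d f K s₀ s₁ → d * (f * s₀) + K * (f * d * s₁) ≡ f * d * (K * s₁ + s₀)
  stirling-step = solve-∀

-- gapTotal j ℓ k ⋅ (n)_k is the total of τ_j over sequences of length ℓ with k values.
gapTotal : ℕ → ℕ → ℕ → ℕ
gapTotal j zero    k       = 0
gapTotal j (suc ℓ) zero    = 0
gapTotal j (suc ℓ) (suc k) = gapTotal j ℓ k + suc k * (gapTotal j ℓ (suc k) + 𝟙 (suc k ≡ᵇ j) * stirling2 ℓ (suc k))

-- A new letter closes no gap; an old letter lengthens the gap after the j-th value
-- exactly when it is the current one.
gapCount : (n j ℓ k : ℕ) → valueSum n ℓ k (gapFrom j) ≡ falling n k * gapTotal j ℓ k
gapCount n j zero    k       = trans (+-identityʳ _) (trans (*-zeroʳ (𝟙 (0 ≡ᵇ k))) (sym (*-zeroʳ (falling n k))))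
gapCount n j (suc ℓ) zero    = valueSum-zero n ℓ (gapFrom j)
gapCount n j (suc ℓ) (suc k) = begin
  valueSum n (suc ℓ) (suc k) (gapFrom j)
    ≡⟨ valueSum-step n ℓ k (gapFrom j) ⟩
  (n ∸ k) * valueSum n ℓ k (λ p → gapFrom j (p ∷ʳ true)) + suc k * valueSum n ℓ (suc k) (λ p → gapFrom j (p ∷ʳ false))
    ≡⟨ cong₂ (λ a b → (n ∸ k) * a + suc k * b) (valueSum-cong n ℓ k (gapFrom-new j)) (valueSum-cong n ℓ (suc k) (gapFrom-old j)) ⟩
  (n ∸ k) * valueSum n ℓ k (gapFrom j) + suc k * valueSum n ℓ (suc k) (λ p → gapFrom j p + 𝟙 (trues p ≡ᵇ j))
    ≡⟨ cong (λ a → (n ∸ k) * valueSum n ℓ k (gapFrom j) + suc k * a)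
            (trans (valueSum-+ n ℓ (suc k) (gapFrom j) (λ p → 𝟙 (trues p ≡ᵇ j))) (cong (valueSum n ℓ (suc k) (gapFrom j) +_) (valueSum-of-trues n ℓ (suc k) (λ c → 𝟙 (c ≡ᵇ j))))) ⟩
  (n ∸ k) * valueSum n ℓ k (gapFrom j) + suc k * (valueSum n ℓ (suc k) (gapFrom j) + 𝟙 (suc k ≡ᵇ j) * valueSum n ℓ (suc k) (λ _ → 1))
    ≡⟨ cong₂ (λ a b → (n ∸ k) * a + suc k * b) (gapCount n j ℓ k)
             (cong₂ (λ a b → a + 𝟙 (suc k ≡ᵇ j) * b) (gapCount n j ℓ (suc k)) (valueCount n ℓ (suc k))) ⟩
  (n ∸ k) * (falling n k * gapTotal j ℓ k) + suc k * (falling n k * (n ∸ k) * gapTotal j ℓ (suc k) + 𝟙 (suc k ≡ᵇ j) * (falling n k * (n ∸ k) * stirling2 ℓ (suc k)))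
    ≡⟨ gap-step (n ∸ k) (falling n k) (suc k) (gapTotal j ℓ k) (gapTotal j ℓ (suc k)) (𝟙 (suc k ≡ᵇ j)) (stirling2 ℓ (suc k)) ⟩
  falling n k * (n ∸ k) * gapTotal j (suc ℓ) (suc k) ∎
  where
  gap-step : ∀ d f K t₀ t₁ β s → d * (f * t₀) + K * (f * d * t₁ + β * (f * d * s)) ≡ f * d * (t₀ + K * (t₁ + β * s))
  gap-step = solve-∀

-- powerSum J ℓ K = Σ_{i<ℓ} J^{i+1} S(ℓ-1-i, K), in Horner form.
powerSum : ℕ → ℕ → ℕ → ℕ
powerSum J zero    K = 0
powerSum J (suc ℓ) K = J * (stirling2 ℓ K + powerSum J ℓ K)

powerSum-step : (J ℓ K : ℕ) → powerSum J (suc ℓ) (suc K) ≡ suc K * powerSum J ℓ (suc K) + powerSum J ℓ K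
powerSum-step J zero    K = trans (*-zeroʳ J) (sym (cong (_+ 0) (*-zeroʳ (suc K))))
powerSum-step J (suc ℓ) K = begin
  J * (stirling2 (suc ℓ) (suc K) + powerSum J (suc ℓ) (suc K))
    ≡⟨ cong (λ r → J * (stirling2 (suc ℓ) (suc K) + r)) (powerSum-step J ℓ K) ⟩
  J * (suc K * stirling2 ℓ (suc K) + stirling2 ℓ K + (suc K * powerSum J ℓ (suc K) + powerSum J ℓ K))
    ≡⟨ regroup J (suc K) (stirling2 ℓ (suc K)) (stirling2 ℓ K) (powerSum J ℓ (suc K)) (powerSum J ℓ K) ⟩
  suc K * (J * (stirling2 ℓ (suc K) + powerSum J ℓ (suc K))) + J * (stirling2 ℓ K + powerSum J ℓ K) ∎
  where
  regroup : ∀ J K s₁ s₀ r₁ r₀ → J * (K * s₁ + s₀ + (K * r₁ + r₀)) ≡ K * (J * (s₁ + r₁)) + J * (s₀ + r₀)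
  regroup = solve-∀

-- With fewer than j values there is no gap after the j-th value.
gapTotal-vanish : (j ℓ k : ℕ) → k < j → gapTotal j ℓ k ≡ 0
gapTotal-vanish j zero    k       _  = refl
gapTotal-vanish j (suc ℓ) zero    _  = refl
gapTotal-vanish j (suc ℓ) (suc k) lt
  rewrite gapTotal-vanish j ℓ k (≤-trans (n≤1+n (suc k)) lt) | gapTotal-vanish j ℓ (suc k) lt | dec-false (suc k ≟ j) (<⇒≢ lt)
  = *-zeroʳ (suc k)

-- From j values on, gapTotal is powerSum: both start at K = j with the same values
-- and then follow the Stirling recurrence.
gapTotal≡powerSum : (j ℓ K : ℕ) → j ≤ K → gapTotal j ℓ K ≡ powerSum j ℓ K
gapTotal≡powerSum j zero    K       _    = refl
gapTotal≡powerSum j (suc ℓ) zero    z≤n  = refl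
gapTotal≡powerSum j (suc ℓ) (suc k) j≤sk with m≤n⇒m<n∨m≡n j≤sk
... | inj₁ (s≤s j≤k)
  rewrite gapTotal≡powerSum j ℓ k j≤k | gapTotal≡powerSum j ℓ (suc k) j≤sk | dec-false (suc k ≟ j) (>⇒≢ (s≤s j≤k))
        | +-identityʳ (powerSum j ℓ (suc k))
  = trans (+-comm (powerSum j ℓ k) _) (sym (powerSum-step j ℓ k))
... | inj₂ refl
  rewrite gapTotal-vanish (suc k) ℓ k (n<1+n k) | gapTotal≡powerSum (suc k) ℓ (suc k) j≤sk | dec-true (suc k ≟ suc k) refl
        | +-identityʳ (stirling2 ℓ (suc k))
  = cong (suc k *_) (+-comm (powerSum (suc k) ℓ (suc k)) _)

sumTo : ℕ → (ℕ → ℕ) → ℕ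
sumTo zero    f = 0
sumTo (suc N) f = f 0 + sumTo N (λ i → f (suc i))

sum-applyUpTo : (f g : ℕ → ℕ) (N : ℕ) → sum (map f (applyUpTo g N)) ≡ sumTo N (λ i → f (g i))
sum-applyUpTo f g zero    = refl
sum-applyUpTo f g (suc N) = cong (f (g 0) +_) (sum-applyUpTo f (λ i → g (suc i)) N)

sumTo-cong : (N : ℕ) {f g : ℕ → ℕ} → (∀ i → f i ≡ g i) → sumTo N f ≡ sumTo N g
sumTo-cong zero    f≗g = refl
sumTo-cong (suc N) f≗g = cong₂ _+_ (f≗g 0) (sumTo-cong N (λ i → f≗g (suc i)))

sumTo-* : (N c : ℕ) (f : ℕ → ℕ) → sumTo N (λ i → c * f i) ≡ c * sumTo N f
sumTo-* zero    c f = sym (*-zeroʳ c)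
sumTo-* (suc N) c f = trans (cong (c * f 0 +_) (sumTo-* N c (λ i → f (suc i)))) (sym (*-distribˡ-+ c _ _))

sumTo-split : (a b : ℕ) (f : ℕ → ℕ) → sumTo (a + b) f ≡ sumTo a f + sumTo b (λ i → f (a + i))
sumTo-split zero    b f = refl
sumTo-split (suc a) b f = trans (cong (f 0 +_) (sumTo-split a b (λ i → f (suc i)))) (sym (+-assoc (f 0) _ _))

sumTo-zero : (N : ℕ) (f : ℕ → ℕ) → (∀ i → f i ≡ 0) → sumTo N f ≡ 0
sumTo-zero zero    f f≗0 = refl
sumTo-zero (suc N) f f≗0 rewrite f≗0 0 = sumTo-zero N (λ i → f (suc i)) (λ i → f≗0 (suc i))

powerSum-expanded : (J ℓ K : ℕ) → powerSum J ℓ K ≡ sumTo ℓ (λ i → J ^ suc i * stirling2 (ℓ ∸ suc i) K)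
powerSum-expanded J zero    K = refl
powerSum-expanded J (suc ℓ) K = begin
  J * (stirling2 ℓ K + powerSum J ℓ K)                           ≡⟨ cong (λ r → J * (stirling2 ℓ K + r)) (powerSum-expanded J ℓ K) ⟩
  J * (stirling2 ℓ K + sumTo ℓ term)                             ≡⟨ distrib J (stirling2 ℓ K) _ ⟩
  J * 1 * stirling2 ℓ K + J * sumTo ℓ term                       ≡⟨ cong (J * 1 * stirling2 ℓ K +_) (sym (sumTo-* ℓ J term)) ⟩
  J * 1 * stirling2 ℓ K + sumTo ℓ (λ i → J * term i)             ≡⟨ cong (J * 1 * stirling2 ℓ K +_) (sumTo-cong ℓ (λ i → sym (*-assoc J _ _))) ⟩
  J * 1 * stirling2 ℓ K + sumTo ℓ (λ i → J * J ^ suc i * stirling2 (ℓ ∸ suc i) K) ∎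
  where
  term : ℕ → ℕ
  term i = J ^ suc i * stirling2 (ℓ ∸ suc i) K
  distrib : ∀ J s r → J * (s + r) ≡ J * 1 * s + J * r
  distrib = solve-∀

stirling2-vanish : (a K : ℕ) → a < K → stirling2 a K ≡ 0
stirling2-vanish zero    (suc K) _ = refl
stirling2-vanish (suc a) (suc K) (s≤s lt)
  rewrite stirling2-vanish a (suc K) (≤-trans (n≤1+n _) (s≤s lt)) | stirling2-vanish a K lt = trans (+-identityʳ _) (*-zeroʳ (suc K))

-- The right-hand side of the lemma is powerSum: the terms it omits, i > ℓ' - m', vanish.
rhsSum≡powerSum : (J ℓ' m' : ℕ) → 1 ≤ m' → m' ≤ ℓ' → rhsSum (suc m') (suc ℓ') J ≡ powerSum J ℓ' m'
rhsSum≡powerSum J ℓ' (suc m'') (s≤s z≤n) m'≤ℓ' = begin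
  rhsSum (suc m') (suc ℓ') J                       ≡⟨ sum-applyUpTo (λ k → J ^ k * stirling2 (suc ℓ' ∸ k ∸ 1) m') suc a ⟩
  sumTo a (λ i → J ^ suc i * stirling2 (ℓ' ∸ i ∸ 1) m') ≡⟨ sumTo-cong a (λ i → cong (λ z → J ^ suc i * stirling2 z m') (trans (∸-+-assoc ℓ' i 1) (cong (ℓ' ∸_) (+-comm i 1)))) ⟩
  sumTo a h                                        ≡⟨ sym (+-identityʳ _) ⟩
  sumTo a h + 0                                    ≡⟨ cong (sumTo a h +_) (sym (sumTo-zero m' (λ i → h (a + i)) tail-vanishes)) ⟩
  sumTo a h + sumTo m' (λ i → h (a + i))           ≡⟨ sym (sumTo-split a m' h) ⟩
  sumTo (a + m') h                                 ≡⟨ cong (λ z → sumTo z h) (m∸n+n≡m m'≤ℓ') ⟩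
  sumTo ℓ' h                                       ≡⟨ sym (powerSum-expanded J ℓ' m') ⟩
  powerSum J ℓ' m'                                 ∎
  where
  m' = suc m''
  a  = ℓ' ∸ m'
  h : ℕ → ℕ
  h i = J ^ suc i * stirling2 (ℓ' ∸ suc i) m'
  tail-index : ∀ i → ℓ' ∸ suc (a + i) ≡ m'' ∸ i
  tail-index i = begin
    ℓ' ∸ suc (a + i)  ≡⟨ cong (ℓ' ∸_) (sym (+-suc a i)) ⟩
    ℓ' ∸ (a + suc i)  ≡⟨ sym (∸-+-assoc ℓ' a (suc i)) ⟩
    ℓ' ∸ a ∸ suc i    ≡⟨ cong (_∸ suc i) (m∸[m∸n]≡n m'≤ℓ') ⟩
    m' ∸ suc i        ∎
  tail-vanishes : ∀ i → h (a + i) ≡ 0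
  tail-vanishes i rewrite tail-index i | stirling2-vanish (m'' ∸ i) m' (s≤s (m∸n≤m m'' i)) = *-zeroʳ (J ^ suc (a + i))

-- Summing over 𝒳_{m+1}^{(ℓ+1)}: the last letter must be one of the n ∸ m values not yet seen.
endsFresh-sum : (n ℓ m : ℕ) (H : List Bool → ℕ) →
  patternSum n (suc ℓ) (λ p → 𝟙 (endsFresh (suc m) p) * H p) ≡ (n ∸ m) * valueSum n ℓ m (λ p → H (p ∷ʳ true))
endsFresh-sum n ℓ m H = begin
  patternSum n (suc ℓ) (λ p → 𝟙 (endsFresh (suc m) p) * H p)
    ≡⟨ patternSum-snoc n ℓ (λ p → 𝟙 (endsFresh (suc m) p) * H p) ⟩
  ∑ (allSeqs n ℓ) (λ xs → step (freshness xs))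
    ≡⟨ ∑-cong (allSeqs n ℓ) (λ xs → pointwise (freshness xs)) ⟩
  ∑ (allSeqs n ℓ) (λ xs → (n ∸ m) * (𝟙 (trues (freshness xs) ≡ᵇ m) * H (freshness xs ∷ʳ true)))
    ≡⟨ ∑-* (allSeqs n ℓ) (n ∸ m) _ ⟩
  (n ∸ m) * valueSum n ℓ m (λ p → H (p ∷ʳ true)) ∎
  where
  step : List Bool → ℕ
  step p = trues p * (𝟙 (endsFresh (suc m) (p ∷ʳ false)) * H (p ∷ʳ false)) + (n ∸ trues p) * (𝟙 (endsFresh (suc m) (p ∷ʳ true)) * H (p ∷ʳ true))
  ends-old : ∀ p → endsFresh (suc m) (p ∷ʳ false) ≡ false
  ends-old p = trans (cong ((trues (p ∷ʳ false) ≡ᵇ suc m) ∧_) (lastB-snoc p false)) (∧-zeroʳ _)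
  ends-new : ∀ p → endsFresh (suc m) (p ∷ʳ true) ≡ (trues p ≡ᵇ m)
  ends-new p = trans (cong₂ (λ c l → (c ≡ᵇ suc m) ∧ l) (trues-snoc-true p) (lastB-snoc p true)) (∧-identityʳ _)
  pointwise : ∀ p → step p ≡ (n ∸ m) * (𝟙 (trues p ≡ᵇ m) * H (p ∷ʳ true))
  pointwise p rewrite ends-old p | ends-new p | *-zeroʳ (trues p) = indicator-subst (n ∸_) (trues p) m (H (p ∷ʳ true))

τ≡gap-on-𝒳 : (j M : ℕ) → suc j ≤ M → (p : List Bool) → 𝟙 (endsFresh M p) * tauP j p ≡ 𝟙 (endsFresh M p) * gapFrom j p
τ≡gap-on-𝒳 j M j<M p with trues p ≡ᵇ M in eq
... | false = refl
... | true  = cong (𝟙 (lastB p) *_) (tauP≡gapFrom j p (subst (suc j ≤_) (sym (≡ᵇ⇒≡ (trues p) M (Equivalence.from T-≡ eq))) j<M))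

size-𝒳 : (n m ℓ : ℕ) → length (Xml n (suc m) (suc ℓ)) ≡ falling n (suc m) * stirling2 ℓ m
size-𝒳 n m ℓ = begin
  length (Xml n (suc m) (suc ℓ))                              ≡⟨ length-filter (inX (suc m)) (allSeqs n (suc ℓ)) ⟩
  ∑ (allSeqs n (suc ℓ)) (λ xs → 𝟙 (inX (suc m) xs))          ≡⟨ ∑-cong (allSeqs n (suc ℓ)) (λ xs → trans (cong 𝟙 (inX≡endsFresh (suc m) xs)) (sym (*-identityʳ _))) ⟩
  patternSum n (suc ℓ) (λ p → 𝟙 (endsFresh (suc m) p) * 1)    ≡⟨ endsFresh-sum n ℓ m (λ _ → 1) ⟩
  (n ∸ m) * valueSum n ℓ m (λ _ → 1)                          ≡⟨ cong ((n ∸ m) *_) (valueCount n ℓ m) ⟩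
  (n ∸ m) * (falling n m * stirling2 ℓ m)                     ≡⟨ reorder (n ∸ m) (falling n m) (stirling2 ℓ m) ⟩
  falling n (suc m) * stirling2 ℓ m                           ∎
  where
  reorder : ∀ d f s → d * (f * s) ≡ f * d * s
  reorder = solve-∀

total-τ-𝒳 : (n m ℓ j : ℕ) → j ≤ m → sum (map (tau j) (Xml n (suc m) (suc ℓ))) ≡ falling n (suc m) * powerSum j ℓ m
total-τ-𝒳 n m ℓ j j≤m = begin
  sum (map (tau j) (Xml n (suc m) (suc ℓ)))                    ≡⟨ ∑-filter (inX (suc m)) (tau j) (allSeqs n (suc ℓ)) ⟩
  ∑ (allSeqs n (suc ℓ)) (λ xs → 𝟙 (inX (suc m) xs) * tau j xs) ≡⟨ ∑-cong (allSeqs n (suc ℓ)) to-pattern ⟩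
  patternSum n (suc ℓ) (λ p → 𝟙 (endsFresh (suc m) p) * gapFrom j p) ≡⟨ endsFresh-sum n ℓ m (gapFrom j) ⟩
  (n ∸ m) * valueSum n ℓ m (λ p → gapFrom j (p ∷ʳ true))       ≡⟨ cong ((n ∸ m) *_) (valueSum-cong n ℓ m (gapFrom-new j)) ⟩
  (n ∸ m) * valueSum n ℓ m (gapFrom j)                         ≡⟨ cong ((n ∸ m) *_) (gapCount n j ℓ m) ⟩
  (n ∸ m) * (falling n m * gapTotal j ℓ m)                     ≡⟨ cong (λ t → (n ∸ m) * (falling n m * t)) (gapTotal≡powerSum j ℓ m j≤m) ⟩
  (n ∸ m) * (falling n m * powerSum j ℓ m)                     ≡⟨ reorder (n ∸ m) (falling n m) (powerSum j ℓ m) ⟩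
  falling n (suc m) * powerSum j ℓ m                           ∎
  where
  reorder : ∀ d f s → d * (f * s) ≡ f * d * s
  reorder = solve-∀
  to-pattern : ∀ xs → 𝟙 (inX (suc m) xs) * tau j xs ≡ 𝟙 (endsFresh (suc m) (freshness xs)) * gapFrom j (freshness xs)
  to-pattern xs = trans (cong₂ _*_ (cong 𝟙 (inX≡endsFresh (suc m) xs)) (tau≡tauP j xs)) (τ≡gap-on-𝒳 j (suc m) (s≤s j≤m) (freshness xs))

/ℕ-cancel : (c a d : ℕ) → 0 < c → (c * a) /ℕ (c * d) ≡ a /ℕ d
/ℕ-cancel c        a zero     _ rewrite *-zeroʳ c = refl
/ℕ-cancel (suc c′) a (suc d′) _ = fromℚᵘ-cong {mkℚᵘ (ℤ⁺ (suc c′ * a)) (d′ + c′ * suc d′)} {mkℚᵘ (ℤ⁺ a) d′}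
  (*≡* (trans (sym (ℤ.pos-* (suc c′ * a) (suc d′))) (trans (cong ℤ⁺ (cross c′ a d′)) (ℤ.pos-* a (suc c′ * suc d′)))))
  where
  cross : ∀ c a d → suc c * a * suc d ≡ a * (suc c * suc d)
  cross = solve-∀

falling-pos : (n k : ℕ) → k ≤ n → 0 < falling n k
falling-pos n zero    _   = s≤s z≤n
falling-pos n (suc k) k<n = *-pos (falling-pos n k (≤-trans (n≤1+n k) k<n)) (m<n⇒0<n∸m k<n)
  where
  *-pos : ∀ {a b} → 0 < a → 0 < b → 0 < a * b
  *-pos {suc a} {suc b} _ _ = s≤s z≤n

lemma2p9 : (n m j ℓ : ℕ) → 1 ≤ j → j ≤ m ∸ 1 → m ≤ n → m ≤ ℓ →
    Etau n m ℓ j ≡ rhsSum m ℓ j /ℕ stirling2 (ℓ ∸ 1) (m ∸ 1)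
lemma2p9 n (suc m) (suc j) (suc ℓ) 1≤j j≤m m≤n (s≤s m≤ℓ) = begin
  Etau n (suc m) (suc ℓ) (suc j)
    ≡⟨ cong₂ _/ℕ_ (total-τ-𝒳 n m ℓ (suc j) j≤m) (size-𝒳 n m ℓ) ⟩
  (falling n (suc m) * powerSum (suc j) ℓ m) /ℕ (falling n (suc m) * stirling2 ℓ m)
    ≡⟨ /ℕ-cancel (falling n (suc m)) _ _ (falling-pos n (suc m) m≤n) ⟩
  powerSum (suc j) ℓ m /ℕ stirling2 ℓ m
    ≡⟨ cong (_/ℕ stirling2 ℓ m) (sym (rhsSum≡powerSum (suc j) ℓ m (≤-trans 1≤j j≤m) m≤ℓ)) ⟩
  rhsSum (suc m) (suc ℓ) (suc j) /ℕ stirling2 ℓ m ∎
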